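{- Let $n\ge 3$ and $3\le k<n$, and let $(C_n,L)$ be an edge-labeled $n$-cycle with positive integer edge labels $\ell_1,\dots,\ell_n$. If $(0,\dots,0,g_k,\dots,g_n)$ (with $k-1$ leading zeros) is a generalized spline on $(C_n,L)$, then $g_k$ is a multiple of $\operatorname{lcm}(\ell_{k-1},\gcd(\ell_k,\dots,\ell_n))$. Moreover, $\operatorname{lcm}(\ell_{k-1},\gcd(\ell_k,\dots,\ell_n))$ is the smallest positive value of $g_k$ for which such a spline $(0,\dots,0,g_k,\dots,g_n)$ exists, i.e. there is a flow-up class $\mathcal{G}_{k-1}$ with leading entry $g_k=\operatorname{lcm}(\ell_{k-1},\gcd(\ell_k,\dots,\ell_n))$.
   Context: An edge-labeled $n$-cycle $(C_n,L)$: vertices $v_1,\dots,v_n$; edge $e_i$ joins $v_i$ and $v_{i+1}$ for $1\le i\le n-1$, and $e_n$ joins $v_n$ and $v_1$; edge $e_i$ carries label $\ell_i$. A generalized spline on $(C_n,L)$ is a tuple $(g_1,\dots,g_n)\in\mathbb{Z}^n$ with $g_i\equiv g_{i+1}\pmod{\ell_i}$ for $1\le i\le n-1$ and $g_n\equiv g_1\pmod{\ell_n}$. A flow-up class $\mathcal{G}_{k-1}$ is a spline whose first $k-1$ entries are $0$ and whose $k$-th entry (the leading element) is nonzero. -}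

module Defs where

open import Data.Nat using (ℕ; zero; suc; _<_; _≤_; _≤?_; _<?_)
open import Data.Nat.GCD using (gcd)
open import Data.Fin using (Fin; toℕ; fromℕ<)
open import Data.List using (List; foldr; filter; map)
open import Data.List.Base using (allFin)
open import Data.Integer using (ℤ; +_; _-_)
open import Data.Integer.Divisibility using (_∣_)
open import Relation.Nullary using (yes; no)
open import Relation.Binary.PropositionalEquality using (_≡_)

-- Conventions: vertices v_1..v_n and edges e_1..e_n are indexed by Fin n;
-- Fin index i (toℕ i = 0,...,n-1) stands for v_{i+1} resp. e_{i+1}.
-- Edge e_{i+1} joins v_{i+1} and v_{i+2} (indices mod n), i.e. Fin index i
-- joins vertex i and vertex (next i).

next : {n : ℕ} → Fin n → Fin n
next {suc n} i with suc (toℕ i) <? suc n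
... | yes p = fromℕ< p
... | no _ = Fin.zero

IsSpline : (n : ℕ) → (Fin n → ℕ) → (Fin n → ℤ) → Set
IsSpline n ℓ g = (i : Fin n) → (+ ℓ i) ∣ (g i - g (next i))

-- gcd(ℓ_k, ..., ℓ_n) for 1-based k: gcd of ℓ at Fin indices j with k ≤ toℕ j + 1
gcdFrom : (n : ℕ) → (Fin n → ℕ) → ℕ → ℕ
gcdFrom n ℓ k = foldr gcd 0 (map ℓ (filter (λ j → k ≤? suc (toℕ j)) (allFin n)))

-- A flow-up class with g_1 = ⋯ = g_{k−1} = 0 is exactly a spline on the path
-- v_{k−1}, v_k, …, v_n, v_1 whose two end values are 0; unrolling the cycle onto ℕ, with vertex n
-- identified with vertex 0, turns it into a sequence on the path 0 — 1 — 2 — ⋯.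
-- Along a path that ends in 0 the value g_k telescopes into the differences across the edges
-- e_k, …, e_n, so gcd(ℓ_k, …, ℓ_n) ∣ g_k, while the edge e_{k−1} from the zero at v_{k−1} gives
-- ℓ_{k−1} ∣ g_k; hence the lcm divides g_k.
-- Conversely, by Bézout a multiple c of gcd(ℓ_k, G′) with G′ = gcd(ℓ_{k+1}, …, ℓ_n) is
-- c = y + (a multiple of ℓ_k) for some multiple y of G′, so y can be taken as the next value and the
-- construction recurses down the path; starting with c = lcm(ℓ_{k−1}, gcd(ℓ_k, …, ℓ_n)) and padding
-- with zeros gives the flow-up class.
module Submission where

open import Defs
open import Data.Nat using (ℕ; _<_; _≤_; _∸_; _+_)
open import Data.Nat.Properties using (m∸n≤m; ≤-<-trans)
open import Data.Nat.LCM using (lcm)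
open import Data.Fin using (Fin; toℕ; fromℕ<)
open import Data.Integer using (ℤ; +_)
open import Data.Integer.Divisibility using (_∣_)
open import Data.Product using (Σ; _×_)
open import Relation.Binary.PropositionalEquality using (_≡_)

open import Data.Bool using (true; false; if_then_else_)
open import Data.Nat using (zero; suc; s≤s; z≤n; z<s; _<?_; _≤?_)
open import Data.Nat.Properties
  using (≤-refl; ≤-reflexive; ≤-pred; <⇒≤; m≤n⇒m≤1+n; <⇒≱; ≮⇒≥; ≤∧≮⇒≡; m≤m+n; m+[n∸m]≡n;
         +-identityʳ; +-comm)
open import Data.Nat.GCD using (gcd; gcd[m,n]∣m; gcd[m,n]∣n; gcd-identityˡ; gcd-GCD; module Bézout)
open import Data.Nat.LCM using (lcm-least; m∣lcm[m,n]; n∣lcm[m,n])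
import Data.Fin as Fin
open import Data.Fin.Properties using (toℕ-fromℕ<; fromℕ<-toℕ; toℕ<n)
open import Data.List using ([]; _∷_; foldr; map; filter; tabulate; applyUpTo; allFin)
open import Data.List.Properties using (map-tabulate; tabulate-cong)
import Data.Nat as ℕ
open import Data.Integer as ℤ using (_-_; -_; _*_)
open import Data.Integer.Properties using (pos-+; pos-*; neg-involutive) renaming (+-identityˡ to +-identityˡᶻ)
open import Data.Integer.Divisibility.Signed
  using (divides; ∣ᵤ⇒∣; ∣⇒∣ᵤ; ∣-refl; ∣-trans; ∣m⇒∣-m; ∣m+n∣n⇒∣m; ∣n⇒∣m*n; 0∣⇒≡0)
  renaming (_∣_ to _∣ˢ_)
open import Data.Integer.Tactic.RingSolver using (solve-∀)
open import Data.Product using (_,_)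
open import Function using (id; _∘_)
open import Relation.Nullary using (Dec; yes; no; does; contradiction)
open import Relation.Nullary.Decidable using (dec-true; dec-false)
open import Relation.Unary using (Decidable)
open import Relation.Binary.PropositionalEquality
  using (_≗_; refl; sym; trans; cong; cong₂; subst; module ≡-Reasoning)

open ≡-Reasoning

∣0 : ∀ {i} → i ∣ˢ + 0
∣0 = divides (+ 0) refl

∣⇒∣0- : ∀ {i m} → i ∣ˢ m → i ∣ˢ (+ 0 - m)
∣⇒∣0- {i} {m} i∣m = subst (i ∣ˢ_) (sym (+-identityˡᶻ (- m))) (∣m⇒∣-m i∣m)

∣0-⇒∣ : ∀ {i m} → i ∣ˢ (+ 0 - m) → i ∣ˢ m
∣0-⇒∣ {i} {m} i∣0-m =
  subst (i ∣ˢ_) (neg-involutive m) (∣m⇒∣-m (subst (i ∣ˢ_) (+-identityˡᶻ (- m)) i∣0-m))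

IsPathSpline : (ℕ → ℕ) → (ℕ → ℤ) → Set
IsPathSpline f x = ∀ i → (+ f i) ∣ˢ (x i - x (suc i))

IsPathSpline-shift : ∀ j {f x} → IsPathSpline f x → IsPathSpline (λ i → f (j + i)) (λ i → x (j + i))
IsPathSpline-shift zero    path = path
IsPathSpline-shift (suc j) {f} {x} path = IsPathSpline-shift j {f ∘ suc} {x ∘ suc} (path ∘ suc)

infixr 5 _◂_

_◂_ : ℤ → (ℕ → ℤ) → ℕ → ℤ
(c ◂ x) zero    = c
(c ◂ x) (suc i) = x i

pad : ℕ → (ℕ → ℤ) → ℕ → ℤ
pad zero    x = x
pad (suc j) x = + 0 ◂ pad j x

pad-+ : ∀ j x i → pad j x (j + i) ≡ x i
pad-+ zero    x i = refl
pad-+ (suc j) x i = pad-+ j x i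

pad-< : ∀ j x {i} → i < j → pad j x i ≡ + 0
pad-< (suc j) x {zero}  _         = refl
pad-< (suc j) x {suc i} (s≤s i<j) = pad-< j x i<j

pad-isPathSpline : ∀ j f x → (+ f j) ∣ˢ (+ 0 - x 0) → IsPathSpline (λ i → f (suc j + i)) x →
                   IsPathSpline f (pad (suc j) x)
pad-isPathSpline zero    f x edge path zero    = edge
pad-isPathSpline zero    f x edge path (suc i) = path i
pad-isPathSpline (suc j) f x edge path zero    = ∣0
pad-isPathSpline (suc j) f x edge path (suc i) = pad-isPathSpline j (f ∘ suc) x edge path i

gcdUpTo : (ℕ → ℕ) → ℕ → ℕ
gcdUpTo f t = foldr gcd 0 (applyUpTo f t)

gcdUpTo-cong : ∀ {f g} → f ≗ g → ∀ t → gcdUpTo f t ≡ gcdUpTo g t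
gcdUpTo-cong f≗g zero    = refl
gcdUpTo-cong f≗g (suc t) = cong₂ gcd (f≗g 0) (gcdUpTo-cong (f≗g ∘ suc) t)

gcdUpTo-+ : ∀ f j t → (∀ {i} → i < j → f i ≡ 0) → gcdUpTo f (j + t) ≡ gcdUpTo (λ i → f (j + i)) t
gcdUpTo-+ f zero    t _      = refl
gcdUpTo-+ f (suc j) t f<j≡0 = begin
  gcd (f 0) (gcdUpTo (f ∘ suc) (j + t)) ≡⟨ cong (λ a → gcd a (gcdUpTo (f ∘ suc) (j + t))) (f<j≡0 z<s) ⟩
  gcd 0 (gcdUpTo (f ∘ suc) (j + t))     ≡⟨ gcd-identityˡ _ ⟩
  gcdUpTo (f ∘ suc) (j + t)             ≡⟨ gcdUpTo-+ (f ∘ suc) j t (f<j≡0 ∘ s≤s) ⟩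
  gcdUpTo (λ i → f (suc j + i)) t       ∎

pathSpline⇒gcdUpTo∣ : ∀ f t {x} → IsPathSpline f x → x t ≡ + 0 → (+ gcdUpTo f t) ∣ˢ x 0
pathSpline⇒gcdUpTo∣ f zero    path x₀≡0 = subst (+ 0 ∣ˢ_) (sym x₀≡0) ∣-refl
pathSpline⇒gcdUpTo∣ f (suc t) {x} path xₜ≡0 =
  ∣m+n∣n⇒∣m (∣-trans gcd∣f₀ (path 0)) (∣m⇒∣-m (∣-trans gcd∣G G∣x₁))
  where
  G : ℕ
  G = gcdUpTo (f ∘ suc) t
  gcd∣f₀ : (+ gcd (f 0) G) ∣ˢ (+ f 0)
  gcd∣f₀ = ∣ᵤ⇒∣ (gcd[m,n]∣m (f 0) G)
  gcd∣G : (+ gcd (f 0) G) ∣ˢ (+ G)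
  gcd∣G = ∣ᵤ⇒∣ (gcd[m,n]∣n (f 0) G)
  G∣x₁ : (+ G) ∣ˢ x 1
  G∣x₁ = pathSpline⇒gcdUpTo∣ (f ∘ suc) t {x ∘ suc} (path ∘ suc) xₜ≡0

ℕ-eq⇒ℤ-eq : ∀ d y b x a → d + y ℕ.* b ≡ x ℕ.* a → + d ℤ.+ + y * + b ≡ + x * + a
ℕ-eq⇒ℤ-eq d y b x a eq = begin
  + d ℤ.+ + y * + b    ≡⟨ cong (λ z → + d ℤ.+ z) (pos-* y b) ⟨
  + d ℤ.+ + (y ℕ.* b)  ≡⟨ pos-+ d (y ℕ.* b) ⟨
  + (d + y ℕ.* b)      ≡⟨ cong +_ eq ⟩
  + (x ℕ.* a)          ≡⟨ pos-* x a ⟩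
  + x * + a            ∎

gcd∣⇒split : ∀ a b {c} → (+ gcd a b) ∣ˢ c → Σ ℤ λ y → (+ b) ∣ˢ y × (+ a) ∣ˢ (c - y)
gcd∣⇒split a b (divides q refl) with Bézout.identity (gcd-GCD a b)
... | Bézout.+- x y eq = - (q * (+ y * + b)) , ∣m⇒∣-m (∣n⇒∣m*n q (∣n⇒∣m*n (+ y) ∣-refl)) ,
  subst (+ a ∣ˢ_) (sym (plus-case q (+ gcd a b) (+ x * + a) (+ y * + b) (ℕ-eq⇒ℤ-eq _ y b x a eq)))
        (∣n⇒∣m*n q (∣n⇒∣m*n (+ x) ∣-refl))
  where
  plus-case : ∀ q d X Y → d ℤ.+ Y ≡ X → q * d - - (q * Y) ≡ q * X
  plus-case q d X Y d+Y≡X = trans (ring q d Y) (cong (q *_) d+Y≡X)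
    where ring : ∀ q d Y → q * d - - (q * Y) ≡ q * (d ℤ.+ Y)
          ring = solve-∀
... | Bézout.-+ x y eq = q * (+ y * + b) , ∣n⇒∣m*n q (∣n⇒∣m*n (+ y) ∣-refl) ,
  subst (+ a ∣ˢ_) (sym (minus-case q (+ gcd a b) (+ x * + a) (+ y * + b) (ℕ-eq⇒ℤ-eq _ x a y b eq)))
        (∣m⇒∣-m (∣n⇒∣m*n q (∣n⇒∣m*n (+ x) ∣-refl)))
  where
  minus-case : ∀ q d X Y → d ℤ.+ X ≡ Y → q * d - q * Y ≡ - (q * X)
  minus-case q d X Y d+X≡Y = trans (cong (λ Z → q * d - q * Z) (sym d+X≡Y)) (ring q d X)
    where ring : ∀ q d X → q * d - q * (d ℤ.+ X) ≡ - (q * X)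
          ring = solve-∀

gcdUpTo∣⇒pathSpline : ∀ f t {c} → (+ gcdUpTo f t) ∣ˢ c →
                      Σ (ℕ → ℤ) λ x → x 0 ≡ c × x t ≡ + 0 × IsPathSpline f x
gcdUpTo∣⇒pathSpline f zero 0∣c = (λ _ → + 0) , sym (0∣⇒≡0 0∣c) , refl , λ _ → ∣0
gcdUpTo∣⇒pathSpline f (suc t) {c} G∣c
  with y , G′∣y , f₀∣c-y ← gcd∣⇒split (f 0) (gcdUpTo (f ∘ suc) t) G∣c
  with x , x₀≡y , xₜ≡0 , path ← gcdUpTo∣⇒pathSpline (f ∘ suc) t G′∣y
  = c ◂ x , refl , xₜ≡0 , λ where
      zero    → subst (λ z → (+ f 0) ∣ˢ (c - z)) (sym x₀≡y) f₀∣c-y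
      (suc i) → path i

-- For f = extend 0 ℓ and j = k − 2 this is lcm(ℓ_{k−1}, gcd(ℓ_k, …, ℓ_n)) in the paper's 1-based indexing.
leadingModulus : (ℕ → ℕ) → ℕ → ℕ → ℕ
leadingModulus f j t = lcm (f j) (gcdUpTo (λ i → f (suc j + i)) t)

pathSpline⇒leadingModulus∣ : ∀ f j t {x} → IsPathSpline f x → x j ≡ + 0 → x (suc j + t) ≡ + 0 →
                             (+ leadingModulus f j t) ∣ x (suc j)
pathSpline⇒leadingModulus∣ f j t {x} path xⱼ≡0 xₑ≡0 = lcm-least (∣⇒∣ᵤ fⱼ∣x) (∣⇒∣ᵤ G∣x)
  where
  fⱼ∣x : (+ f j) ∣ˢ x (suc j)
  fⱼ∣x = ∣0-⇒∣ (subst (λ z → (+ f j) ∣ˢ (z - x (suc j))) xⱼ≡0 (path j))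
  G∣x : (+ gcdUpTo (λ i → f (suc j + i)) t) ∣ˢ x (suc j)
  G∣x = subst (_ ∣ˢ_) (cong x (+-identityʳ (suc j)))
          (pathSpline⇒gcdUpTo∣ _ t {λ i → x (suc j + i)} (IsPathSpline-shift (suc j) {f} {x} path) xₑ≡0)

leadingModulus-attained : ∀ f j t → Σ (ℕ → ℤ) λ x → IsPathSpline f x × (∀ {i} → i ≤ j → x i ≡ + 0) ×
                          x (suc j) ≡ + leadingModulus f j t × x (suc j + t) ≡ + 0
leadingModulus-attained f j t
  with y , y₀≡m , yₜ≡0 , path ← gcdUpTo∣⇒pathSpline (λ i → f (suc j + i)) t
                                  (∣ᵤ⇒∣ (n∣lcm[m,n] (f j) (gcdUpTo (λ i → f (suc j + i)) t)))
  = pad (suc j) y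
  , pad-isPathSpline j f y (subst (λ z → (+ f j) ∣ˢ (+ 0 - z)) (sym y₀≡m) (∣⇒∣0- fⱼ∣m)) path
  , (λ i≤j → pad-< (suc j) y (s≤s i≤j))
  , trans (cong (pad (suc j) y) (sym (+-identityʳ (suc j)))) (trans (pad-+ (suc j) y 0) y₀≡m)
  , trans (pad-+ (suc j) y t) yₜ≡0
  where
  fⱼ∣m : (+ f j) ∣ˢ (+ leadingModulus f j t)
  fⱼ∣m = ∣ᵤ⇒∣ (m∣lcm[m,n] (f j) (gcdUpTo (λ i → f (suc j + i)) t))

extend : ∀ {n} {A : Set} → A → (Fin n → A) → ℕ → A
extend {n} a f i with i <? n
... | yes i<n = f (fromℕ< i<n)
... | no  _   = a

extend-toℕ : ∀ {n} {A : Set} (a : A) (f : Fin n → A) i → extend a f (toℕ i) ≡ f i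
extend-toℕ {n} a f i with toℕ i <? n
... | yes i<n = cong f (fromℕ<-toℕ i i<n)
... | no  i≮n = contradiction (toℕ<n i) i≮n

extend-≥ : ∀ {n} {A : Set} (a : A) (f : Fin n → A) {i} → n ≤ i → extend a f i ≡ a
extend-≥ {n} a f {i} n≤i with i <? n
... | yes i<n = contradiction n≤i (<⇒≱ i<n)
... | no  _   = refl

extend-≡ : ∀ {n} {A : Set} (a : A) (f : Fin n → A) {i} →
           (∀ j → toℕ j ≡ i → f j ≡ a) → extend a f i ≡ a
extend-≡ {n} a f {i} f≡a with i <? n
... | yes i<n = f≡a (fromℕ< i<n) (toℕ-fromℕ< i<n)
... | no  _   = refl

-- Since gcd 0 m ≡ m, removing entries from the list is the same as replacing them by 0.
gcd-filter : ∀ {A : Set} {P : A → Set} (P? : Decidable P) (f : A → ℕ) xs →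
             foldr gcd 0 (map f (filter P? xs)) ≡ foldr gcd 0 (map (λ x → if does (P? x) then f x else 0) xs)
gcd-filter P? f []       = refl
gcd-filter P? f (x ∷ xs) with does (P? x)
... | true  = cong (gcd (f x)) (gcd-filter P? f xs)
... | false = trans (gcd-filter P? f xs) (sym (gcd-identityˡ _))

tabulate-toℕ : ∀ {A : Set} (f : ℕ → A) n → tabulate {n = n} (f ∘ toℕ) ≡ applyUpTo f n
tabulate-toℕ f zero    = refl
tabulate-toℕ f (suc n) = cong (f 0 ∷_) (tabulate-toℕ (f ∘ suc) n)

gcdFrom≡gcdUpTo : ∀ n (ℓ : Fin n → ℕ) j → j ≤ n →
                  gcdFrom n ℓ (suc j) ≡ gcdUpTo (λ i → extend 0 ℓ (j + i)) (n ∸ j)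
gcdFrom≡gcdUpTo n ℓ j j≤n = begin
  foldr gcd 0 (map ℓ (filter P? (allFin n)))                    ≡⟨ gcd-filter P? ℓ (allFin n) ⟩
  foldr gcd 0 (map masked (allFin n))                           ≡⟨ cong (foldr gcd 0) (map-tabulate id masked) ⟩
  foldr gcd 0 (tabulate masked)                                 ≡⟨ cong (foldr gcd 0) (tabulate-cong masked≡mask) ⟩
  foldr gcd 0 (tabulate {n = n} (mask ∘ toℕ))                   ≡⟨ cong (foldr gcd 0) (tabulate-toℕ mask n) ⟩
  gcdUpTo mask n                                                ≡⟨ cong (gcdUpTo mask) (m+[n∸m]≡n j≤n) ⟨
  gcdUpTo mask (j + (n ∸ j))                                    ≡⟨ gcdUpTo-+ mask j (n ∸ j) mask-< ⟩
  gcdUpTo (λ i → mask (j + i)) (n ∸ j)                          ≡⟨ gcdUpTo-cong mask-+ (n ∸ j) ⟩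
  gcdUpTo (λ i → extend 0 ℓ (j + i)) (n ∸ j)                    ∎
  where
  P? : (x : Fin n) → Dec (suc j ≤ suc (toℕ x))
  P? x = suc j ≤? suc (toℕ x)
  masked : Fin n → ℕ
  masked x = if does (P? x) then ℓ x else 0
  mask : ℕ → ℕ
  mask i = if does (suc j ≤? suc i) then extend 0 ℓ i else 0
  masked≡mask : ∀ x → masked x ≡ mask (toℕ x)
  masked≡mask x = cong (λ a → if does (P? x) then a else 0) (sym (extend-toℕ 0 ℓ x))
  mask-< : ∀ {i} → i < j → mask i ≡ 0
  mask-< {i} i<j = cong (λ b → if b then extend 0 ℓ i else 0) (dec-false (suc j ≤? suc i) (<⇒≱ (s≤s i<j)))
  mask-+ : ∀ i → mask (j + i) ≡ extend 0 ℓ (j + i)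
  mask-+ i = cong (λ b → if b then extend 0 ℓ (j + i) else 0) (dec-true (suc j ≤? suc (j + i)) (s≤s (m≤m+n j i)))

next-toℕ : ∀ {n} {A : Set} (x : ℕ → A) → x 0 ≡ x (suc n) →
           (i : Fin (suc n)) → x (toℕ (next i)) ≡ x (suc (toℕ i))
next-toℕ {n} x x₀≡xₙ i with suc (toℕ i) <? suc n
... | yes i+1<n = cong x (toℕ-fromℕ< i+1<n)
... | no  i+1≮n = trans x₀≡xₙ (cong x (sym (≤∧≮⇒≡ (toℕ<n i) i+1≮n)))

spline⇒pathSpline : ∀ {n} (ℓ : Fin (suc n) → ℕ) (g : Fin (suc n) → ℤ) →
                    g Fin.zero ≡ + 0 → IsSpline (suc n) ℓ g → IsPathSpline (extend 0 ℓ) (extend (+ 0) g)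
spline⇒pathSpline {n} ℓ g g₀≡0 spline i = edgeOrBeyond (i <? suc n)
  where
  ĝ : ℕ → ℤ
  ĝ = extend (+ 0) g
  ĝ₀≡ĝₙ : ĝ 0 ≡ ĝ (suc n)
  ĝ₀≡ĝₙ = trans (extend-toℕ (+ 0) g Fin.zero) (trans g₀≡0 (sym (extend-≥ (+ 0) g ≤-refl)))
  edge : ∀ j → (+ extend 0 ℓ (toℕ j)) ∣ˢ (ĝ (toℕ j) - ĝ (suc (toℕ j)))
  edge j rewrite extend-toℕ 0 ℓ j | extend-toℕ (+ 0) g j
               | sym (next-toℕ ĝ ĝ₀≡ĝₙ j) | extend-toℕ (+ 0) g (next j) = ∣ᵤ⇒∣ (spline j)
  edgeOrBeyond : Dec (i < suc n) → (+ extend 0 ℓ i) ∣ˢ (ĝ i - ĝ (suc i))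
  edgeOrBeyond (yes i<n) =
    subst (λ j → (+ extend 0 ℓ j) ∣ˢ (ĝ j - ĝ (suc j))) (toℕ-fromℕ< i<n) (edge (fromℕ< i<n))
  edgeOrBeyond (no  i≮n)
    rewrite extend-≥ 0 ℓ (≮⇒≥ i≮n) | extend-≥ (+ 0) g (≮⇒≥ i≮n)
          | extend-≥ (+ 0) g (m≤n⇒m≤1+n (≮⇒≥ i≮n))
    = ∣-refl

pathSpline⇒spline : ∀ {n} (ℓ : Fin (suc n) → ℕ) (x : ℕ → ℤ) →
                    x 0 ≡ x (suc n) → IsPathSpline (extend 0 ℓ) x → IsSpline (suc n) ℓ (x ∘ toℕ)
pathSpline⇒spline ℓ x x₀≡xₙ path i rewrite next-toℕ x x₀≡xₙ i =
  ∣⇒∣ᵤ (subst (λ a → (+ a) ∣ˢ (x (toℕ i) - x (suc (toℕ i)))) (extend-toℕ 0 ℓ i) (path (toℕ i)))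

toℕ≡suc⇒< : ∀ {n j} (i : Fin (suc n)) → toℕ i ≡ suc j → j < n
toℕ≡suc⇒< i i≡1+j = ≤-pred (subst (_< suc _) i≡1+j (toℕ<n i))

flowUp-leading-∣ : ∀ {n} (ℓ : Fin (suc n) → ℕ) (g : Fin (suc n) → ℤ) j (lead : Fin (suc n)) →
                   toℕ lead ≡ suc j → IsSpline (suc n) ℓ g → (∀ i → toℕ i ≤ j → g i ≡ + 0) →
                   (+ leadingModulus (extend 0 ℓ) j (n ∸ j)) ∣ g lead
flowUp-leading-∣ {n} ℓ g j lead lead≡1+j spline zeros =
  subst ((+ leadingModulus (extend 0 ℓ) j (n ∸ j)) ∣_) ĝ-lead
        (pathSpline⇒leadingModulus∣ (extend 0 ℓ) j (n ∸ j) {ĝ} path ĝⱼ≡0 ĝ-end≡0)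
  where
  ĝ : ℕ → ℤ
  ĝ = extend (+ 0) g
  path : IsPathSpline (extend 0 ℓ) ĝ
  path = spline⇒pathSpline ℓ g (zeros Fin.zero z≤n) spline
  ĝⱼ≡0 : ĝ j ≡ + 0
  ĝⱼ≡0 = extend-≡ (+ 0) g (λ i i≡j → zeros i (≤-reflexive i≡j))
  j≤n : j ≤ n
  j≤n = <⇒≤ (toℕ≡suc⇒< lead lead≡1+j)
  ĝ-end≡0 : ĝ (suc j + (n ∸ j)) ≡ + 0
  ĝ-end≡0 = extend-≥ (+ 0) g (≤-reflexive (cong suc (sym (m+[n∸m]≡n j≤n))))
  ĝ-lead : ĝ (suc j) ≡ g lead
  ĝ-lead = trans (cong ĝ (sym lead≡1+j)) (extend-toℕ (+ 0) g lead)

flowUp-exists : ∀ {n} (ℓ : Fin (suc n) → ℕ) j (lead : Fin (suc n)) → toℕ lead ≡ suc j →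
                Σ (Fin (suc n) → ℤ) λ g → IsSpline (suc n) ℓ g × (∀ i → toℕ i ≤ j → g i ≡ + 0) ×
                  g lead ≡ + leadingModulus (extend 0 ℓ) j (n ∸ j)
flowUp-exists {n} ℓ j lead lead≡1+j
  with x , path , zeros , leading , x-end≡0 ← leadingModulus-attained (extend 0 ℓ) j (n ∸ j)
  = x ∘ toℕ , pathSpline⇒spline ℓ x x₀≡xₙ path , (λ i → zeros) , trans (cong x lead≡1+j) leading
  where
  x₀≡xₙ : x 0 ≡ x (suc n)
  x₀≡xₙ = trans (zeros z≤n)
                (trans (sym x-end≡0) (cong (x ∘ suc) (m+[n∸m]≡n (<⇒≤ (toℕ≡suc⇒< lead lead≡1+j)))))

m≤n⇒m+1<2+n : ∀ {m n} → m ≤ n → m + 1 < suc (suc n)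
m≤n⇒m+1<2+n {m} {n} m≤n = s≤s (subst (_≤ suc n) (+-comm 1 m) (s≤s m≤n))

m+1<2+n⇒m≤n : ∀ {m n} → m + 1 < suc (suc n) → m ≤ n
m+1<2+n⇒m≤n {m} {n} m+1<2+n = ≤-pred (≤-pred (subst (_< suc (suc n)) (+-comm m 1) m+1<2+n))

theorem4p5 : (n : ℕ) → 3 ≤ n → (k : ℕ) → 3 ≤ k → (k<n : k < n) →
    (ℓ : Fin n → ℕ) → ((i : Fin n) → 0 < ℓ i) →
    let m = lcm (ℓ (fromℕ< (≤-<-trans (m∸n≤m k 2) k<n))) (gcdFrom n ℓ k)
        gk = fromℕ< (≤-<-trans (m∸n≤m k 1) k<n)
    in ((g : Fin n → ℤ) → IsSpline n ℓ g →
          ((i : Fin n) → toℕ i + 1 < k → g i ≡ + 0) → (+ m) ∣ g gk)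
       × Σ (Fin n → ℤ) (λ g → IsSpline n ℓ g
          × ((i : Fin n) → toℕ i + 1 < k → g i ≡ + 0) × g gk ≡ + m)
theorem4p5 _ _ (suc (suc (suc j))) (s≤s (s≤s (s≤s z≤n))) (s≤s {n = n} k≤n) ℓ _ =
  (λ g spline zeros → subst (λ m → (+ m) ∣ g lead) modulus
     (flowUp-leading-∣ ℓ g (suc j) lead lead≡2+j spline (λ i i≤j → zeros i (m≤n⇒m+1<2+n i≤j))))
  , (let g , spline , zeros , leading = flowUp-exists ℓ (suc j) lead lead≡2+j
     in g , spline , (λ i i+1<k → zeros i (m+1<2+n⇒m≤n i+1<k)) , trans leading (cong +_ modulus))
  where
  last<n : 3 + j ∸ 2 < suc n
  last<n = ≤-<-trans (m∸n≤m (3 + j) 2) (s≤s k≤n)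
  lead<n : 3 + j ∸ 1 < suc n
  lead<n = ≤-<-trans (m∸n≤m (3 + j) 1) (s≤s k≤n)
  lead : Fin (suc n)
  lead = fromℕ< lead<n
  lead≡2+j : toℕ lead ≡ suc (suc j)
  lead≡2+j = toℕ-fromℕ< lead<n
  modulus : leadingModulus (extend 0 ℓ) (suc j) (n ∸ suc j) ≡
            lcm (ℓ (fromℕ< last<n)) (gcdFrom (suc n) ℓ (3 + j))
  modulus = cong₂ lcm (trans (cong (extend 0 ℓ) (sym (toℕ-fromℕ< last<n))) (extend-toℕ 0 ℓ _))
                      (sym (gcdFrom≡gcdUpTo (suc n) ℓ (suc (suc j)) (m≤n⇒m≤1+n (<⇒≤ k≤n))))
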